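{- Let $k\ge1$ and let $\{A_1,A_2\}$ be a $(k^2+1,2,k,1)$-SEDF in $\mathbb{Z}_{k^2+1}$ with $A_1=\{x_1,\ldots,x_k\}$ and $A_2=\{y_1,\ldots,y_k\}$, where (viewing elements as integers in $\{0,1,\ldots,k^2\}$) $x_i<y_j$ for all $1\le i,j\le k$. Let $a$ be a positive integer. Then $\{B_1,B_2\}$ is an $((ak)^2+1,2,ak,1)$-SEDF in $\mathbb{Z}_{(ak)^2+1}$, where $B_1=\bigcup_{i=1}^k\{a x_i+\alpha: 0\le\alpha\le a-1\}$ and $B_2=\bigcup_{i=1}^k\{a(y_i+k^2\beta): 0\le\beta\le a-1\}$, with the integers $x_i,y_i$ interpreted as the elements of $\mathbb{Z}_{(ak)^2+1}$ with these labels.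
   Context: Elements of $\mathbb{Z}_n$ are $\{0,1,\ldots,n-1\}$ with the natural integer ordering. For an additive group $G$ of order $n$, an $(n,m,k,\lambda)$-SEDF is a set of $m\ge2$ pairwise disjoint $k$-subsets $A_1,\ldots,A_m$ of $G$ such that for every $i$ the multiset $\{x-y: x\in A_i, y\in \bigcup_{j\neq i}A_j\}$ contains every non-zero element of $G$ exactly $\lambda$ times. -}

module Defs where

open import Data.Nat using (ℕ; zero; suc; _+_; _*_; _∸_; _<_; _≤_; NonZero)
open import Data.Nat.DivMod using (_%_)
open import Data.Nat.Properties using (_≟_)
open import Data.Fin as Fin using (Fin)
open import Data.List using (List; []; _∷_; length; map; concatMap; filter; allFin; upTo)
open import Data.List.Relation.Unary.All using (All)
open import Data.List.Relation.Unary.Unique.Propositional using (Unique)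
open import Data.List.Membership.Propositional using (_∈_)
open import Data.Vec using (Vec; lookup; []; _∷_)
open import Data.Product using (_×_)
open import Relation.Nullary using (¬_; does)
open import Relation.Binary.PropositionalEquality using (_≡_)
open import Data.Bool using (if_then_else_)

-- Z_n is modelled by the naturals {0,…,n-1}; subtraction modulo n.
subℤ : (n : ℕ) → .{{NonZero n}} → ℕ → ℕ → ℕ
subℤ n x y = (x + (n ∸ y)) % n

others : {m : ℕ} → (Fin m → List ℕ) → Fin m → List ℕ
others {m} As i = concatMap (λ j → if does (j Fin.≟ i) then [] else As j) (allFin m)

diffs : (n : ℕ) → .{{NonZero n}} → {m : ℕ} → (Fin m → List ℕ) → Fin m → List ℕ
diffs n As i = concatMap (λ x → map (λ y → subℤ n x y) (others As i)) (As i)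

count : ℕ → List ℕ → ℕ
count g l = length (filter (λ d → d ≟ g) l)

record IsSEDF (n m k lam : ℕ) .{{_ : NonZero n}} (As : Fin m → List ℕ) : Set where
  field
    two≤m    : 2 ≤ m
    inZn     : ∀ i → All (_< n) (As i)
    distinct : ∀ i → Unique (As i)
    size     : ∀ i → length (As i) ≡ k
    disjoint : ∀ i j → ¬ i ≡ j → ∀ {x} → x ∈ As i → ¬ x ∈ As j
    external : ∀ i (g : ℕ) → 0 < g → g < n → count g (diffs n As i) ≡ lam

pair : List ℕ → List ℕ → Fin 2 → List ℕ
pair xs ys i = lookup (xs ∷ ys ∷ []) i

B₁ : (N a : ℕ) → .{{NonZero N}} → List ℕ → List ℕ
B₁ N a xs = concatMap (λ x → map (λ α → (a * x + α) % N) (upTo a)) xs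

B₂ : (N a k : ℕ) → .{{NonZero N}} → List ℕ → List ℕ
B₂ N a k ys = concatMap (λ y → map (λ β → (a * (y + k * k * β)) % N) (upTo a)) ys

module Submission where

-- Since every element of A₁ lies below every element of A₂, the difference y − x of x ∈ A₁ and
-- y ∈ A₂ involves no wrap-around, while x − y = n − (y − x); as g ↦ n − g permutes 1, …, n − 1,
-- each of the two SEDF conditions says that the forward differences y − x list 1, …, k² once
-- each. For the blown-up sets a(y + k²β) − (ax + α) = a(e + k²β) − α with e = y − x, and
-- (e, α, β) ↦ a(e + k²β) − α is a mixed-radix bijection from [1, k²] × [0, a) × [0, a) onto
-- [1, a²k²]. So the forward differences of B₁ and B₂ list 1, …, (ak)² once each, and B₁ still
-- lies below B₂, which makes {B₁, B₂} an SEDF again.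

open import Defs
open import Data.Nat.Base using (ℕ; suc; _+_; _*_; _∸_; _<_; _≤_; z≤n; s≤s; s≤s⁻¹; z<s;
  NonZero; >-nonZero; >-nonZero⁻¹; ≢-nonZero⁻¹)
open import Data.Nat.Properties
open import Data.Nat.DivMod
  using (_%_; _/_; m<n⇒m%n≡m; [m+n]%n≡m%n; [m+kn]%n≡m%n; m%n<n; m<n*o⇒m/o<n; m≡m%n+[m/n]*n)
open import Data.Nat.Tactic.RingSolver using (solve-∀)
open import Algebra.Properties.CommutativeSemigroup +-commutativeSemigroup using (interchange)
open import Data.Fin.Base using (zero; suc)
open import Data.List.Base
  using (List; []; _∷_; _++_; map; concatMap; length; upTo; cartesianProductWith)
open import Data.List.Properties
  using (filter-accept; filter-reject; map-cong-local; ++-identityʳ; length-++; length-map; length-upTo)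
open import Data.List.Relation.Unary.Any using (here; there)
open import Data.List.Relation.Unary.All using (All)
import Data.List.Relation.Unary.All as All
import Data.List.Relation.Unary.All.Properties as All
open import Data.List.Relation.Unary.Unique.Propositional using (Unique; []; _∷_)
open import Data.List.Relation.Unary.Unique.Propositional.Properties using (++⁺; upTo⁺)
open import Data.List.Relation.Binary.Disjoint.Propositional using (Disjoint)
open import Data.List.Membership.Propositional using (_∈_; _∉_)
open import Data.List.Membership.Propositional.Properties
  using (∈-upTo⁺; ∈-upTo⁻; ∈-map⁻; ∈-cartesianProductWith⁺; ∈-cartesianProductWith⁻)
open import Data.Product.Base using (_×_; _,_; ∃-syntax; proj₁; proj₂)
open import Function.Base using (_∘_)
open import Function.Bundles using (_⇔_; mk⇔; Equivalence)
open import Relation.Nullary using (Dec; yes; no; contradiction)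
open import Relation.Binary.PropositionalEquality

-- Opaque because unfolding the `with` blocks the unification problems posed by sums of δ.
opaque
  δ : ℕ → ℕ → ℕ
  δ x y with x ≟ y
  ... | yes _ = 1
  ... | no  _ = 0

  ≡⇒δ≡1 : ∀ {x y} → x ≡ y → δ x y ≡ 1
  ≡⇒δ≡1 {x} {y} x≡y with x ≟ y
  ... | yes _   = refl
  ... | no  x≢y = contradiction x≡y x≢y

  ≢⇒δ≡0 : ∀ {x y} → x ≢ y → δ x y ≡ 0
  ≢⇒δ≡0 {x} {y} x≢y with x ≟ y
  ... | yes x≡y = contradiction x≡y x≢y
  ... | no  _   = refl

δ-cong : ∀ {x y x′ y′} → x ≡ y ⇔ x′ ≡ y′ → δ x y ≡ δ x′ y′
δ-cong {x} {y} {x′} {y′} x≡y⇔x′≡y′ = by-cases (x ≟ y)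
  where
  by-cases : Dec (x ≡ y) → δ x y ≡ δ x′ y′
  by-cases (yes x≡y) = trans (≡⇒δ≡1 x≡y) (sym (≡⇒δ≡1 (Equivalence.to x≡y⇔x′≡y′ x≡y)))
  by-cases (no  x≢y) = trans (≢⇒δ≡0 x≢y) (sym (≢⇒δ≡0 (x≢y ∘ Equivalence.from x≡y⇔x′≡y′)))

δ-reflect : ∀ {n d g} → d ≤ n → g ≤ n → δ (n ∸ d) g ≡ δ d (n ∸ g)
δ-reflect {n} {d} {g} d≤n g≤n = δ-cong (mk⇔
  (λ n∸d≡g → trans (sym (m∸[m∸n]≡n d≤n)) (cong (n ∸_) n∸d≡g))
  (λ d≡n∸g → trans (cong (n ∸_) d≡n∸g) (m∸[m∸n]≡n g≤n)))

δ-∸ : ∀ {m n o} → n ≤ m → δ (m ∸ n) o ≡ δ m (o + n)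
δ-∸ {m} {n} {o} n≤m = δ-cong (mk⇔
  (λ m∸n≡o → trans (sym (m∸n+n≡m n≤m)) (cong (_+ n) m∸n≡o))
  (λ m≡o+n → trans (cong (_∸ n) m≡o+n) (m+n∸n≡m o n)))

∑ : {A : Set} → List A → (A → ℕ) → ℕ
∑ []      f = 0
∑ (u ∷ l) f = f u + ∑ l f

syntax ∑ l (λ u → t) = ∑[ u ∈ l ] t

∑-cong : ∀ {A : Set} {f g : A → ℕ} (l : List A) →
         (∀ {u} → u ∈ l → f u ≡ g u) → ∑ l f ≡ ∑ l g
∑-cong []      _   = refl
∑-cong (u ∷ l) f≡g = cong₂ _+_ (f≡g (here refl)) (∑-cong l (f≡g ∘ there))

∑-vanishing : ∀ {A : Set} {f : A → ℕ} (l : List A) → (∀ {u} → u ∈ l → f u ≡ 0) → ∑ l f ≡ 0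
∑-vanishing []      _   = refl
∑-vanishing (u ∷ l) f≡0 = cong₂ _+_ (f≡0 (here refl)) (∑-vanishing l (f≡0 ∘ there))

∑-distrib-+ : ∀ {A : Set} (l : List A) (f g : A → ℕ) →
              ∑[ u ∈ l ] (f u + g u) ≡ ∑ l f + ∑ l g
∑-distrib-+ []      f g = refl
∑-distrib-+ (u ∷ l) f g =
  trans (cong (f u + g u +_) (∑-distrib-+ l f g)) (interchange (f u) (g u) (∑ l f) (∑ l g))

∑-swap : ∀ {A B : Set} (U : List A) (V : List B) (f : A → B → ℕ) →
         ∑[ u ∈ U ] ∑[ v ∈ V ] f u v ≡ ∑[ v ∈ V ] ∑[ u ∈ U ] f u v
∑-swap []      V f = sym (∑-vanishing V (λ _ → refl))
∑-swap (u ∷ U) V f = trans (cong (∑ V (f u) +_) (∑-swap U V f)) (sym (∑-distrib-+ V (f u) _))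

∑-++ : ∀ {A : Set} (l l′ : List A) (f : A → ℕ) → ∑ (l ++ l′) f ≡ ∑ l f + ∑ l′ f
∑-++ []      l′ f = refl
∑-++ (u ∷ l) l′ f = trans (cong (f u +_) (∑-++ l l′ f)) (sym (+-assoc (f u) _ _))

∑-map : ∀ {A B : Set} (h : A → B) (l : List A) (f : B → ℕ) → ∑ (map h l) f ≡ ∑[ u ∈ l ] f (h u)
∑-map h []      f = refl
∑-map h (u ∷ l) f = cong (f (h u) +_) (∑-map h l f)

∑-cartesianProductWith : ∀ {A B C : Set} (h : A → B → C) (U : List A) (V : List B) (f : C → ℕ) →
                         ∑ (cartesianProductWith h U V) f ≡ ∑[ u ∈ U ] ∑[ v ∈ V ] f (h u v)
∑-cartesianProductWith h []      V f = refl
∑-cartesianProductWith h (u ∷ U) V f =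
  trans (∑-++ (map (h u) V) _ f) (cong₂ _+_ (∑-map (h u) V f) (∑-cartesianProductWith h U V f))

count-cons : ∀ g x l → count g (x ∷ l) ≡ δ x g + count g l
count-cons g x l = by-cases (x ≟ g)
  where
  by-cases : Dec (x ≡ g) → count g (x ∷ l) ≡ δ x g + count g l
  by-cases (yes x≡g) =
    trans (cong length (filter-accept (_≟ g) x≡g)) (cong (_+ count g l) (sym (≡⇒δ≡1 x≡g)))
  by-cases (no  x≢g) =
    trans (cong length (filter-reject (_≟ g) x≢g)) (cong (_+ count g l) (sym (≢⇒δ≡0 x≢g)))

count≡∑δ : ∀ {g} l → count g l ≡ ∑[ u ∈ l ] δ u g
count≡∑δ         []      = refl
count≡∑δ {g} (x ∷ l) = trans (count-cons g x l) (cong (δ x g +_) (count≡∑δ l))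

∑-single : ∀ {u₀ f} (l : List ℕ) → (∀ {u} → u ∈ l → u ≢ u₀ → f u ≡ 0) →
           ∑ l f ≡ count u₀ l * f u₀
∑-single         []      _   = refl
∑-single {u₀} {f} (u ∷ l) f≡0 = begin
  f u + ∑ l f                          ≡⟨ cong₂ _+_ (head (u ≟ u₀)) (∑-single l (f≡0 ∘ there)) ⟩
  δ u u₀ * f u₀ + count u₀ l * f u₀    ≡⟨ *-distribʳ-+ (f u₀) (δ u u₀) (count u₀ l) ⟨
  (δ u u₀ + count u₀ l) * f u₀         ≡⟨ cong (_* f u₀) (count-cons u₀ u l) ⟨
  count u₀ (u ∷ l) * f u₀              ∎
  where
  open ≡-Reasoning
  head : Dec (u ≡ u₀) → f u ≡ δ u u₀ * f u₀
  head (yes refl) = sym (trans (cong (_* f u) (≡⇒δ≡1 {u} refl)) (*-identityˡ (f u)))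
  head (no  u≢u₀) = trans (f≡0 (here refl) u≢u₀) (cong (_* f u₀) (sym (≢⇒δ≡0 u≢u₀)))

∑-collapse : ∀ {u₀ f} (l : List ℕ) → count u₀ l ≡ 1 →
             (∀ {u} → u ∈ l → u ≢ u₀ → f u ≡ 0) → ∑ l f ≡ f u₀
∑-collapse {u₀} {f} l once f≡0 =
  trans (∑-single l f≡0) (trans (cong (_* f u₀) once) (*-identityˡ (f u₀)))

count-cartesianProductWith : ∀ {A B : Set} {g} (h : A → B → ℕ) (U : List A) (V : List B) →
  count g (cartesianProductWith h U V) ≡ ∑[ u ∈ U ] ∑[ v ∈ V ] δ (h u v) g
count-cartesianProductWith {g = g} h U V =
  trans (count≡∑δ (cartesianProductWith h U V)) (∑-cartesianProductWith h U V (λ w → δ w g))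

count-∉ : ∀ {g l} → g ∉ l → count g l ≡ 0
count-∉ {g} {l} g∉l = trans (count≡∑δ l)
  (∑-vanishing l (λ u∈l → ≢⇒δ≡0 (λ u≡g → g∉l (subst (_∈ l) u≡g u∈l))))

count-unique : ∀ {g l} → Unique l → g ∈ l → count g l ≡ 1
count-unique {g} {x ∷ l} (x∉l ∷ _) (here refl) =
  trans (count-cons x x l) (cong₂ _+_ (≡⇒δ≡1 refl) (count-∉ (All.All¬⇒¬Any x∉l)))
count-unique {g} {x ∷ l} (x∉l ∷ l!) (there g∈l) =
  trans (count-cons g x l) (cong₂ _+_ (≢⇒δ≡0 (All.lookup x∉l g∈l)) (count-unique l! g∈l))

count-upTo : ∀ {i n} → i < n → count i (upTo n) ≡ 1
count-upTo {i} {n} i<n = count-unique (upTo⁺ n) (∈-upTo⁺ i<n)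

concatMap-map≡cartesianProductWith : ∀ {A B C : Set} {f g : A → B → C} {xs ys} →
  (∀ {x y} → x ∈ xs → y ∈ ys → g x y ≡ f x y) →
  concatMap (λ x → map (g x) ys) xs ≡ cartesianProductWith f xs ys
concatMap-map≡cartesianProductWith {xs = []}     _   = refl
concatMap-map≡cartesianProductWith {xs = x ∷ xs} g≡f =
  cong₂ _++_ (map-cong-local (All.tabulate (g≡f (here refl))))
             (concatMap-map≡cartesianProductWith (g≡f ∘ there))

concatMap-%≡cartesianProductWith : ∀ {A B : Set} {N} .{{_ : NonZero N}} (f : A → B → ℕ) xs ys →
  All (_< N) (cartesianProductWith f xs ys) →
  concatMap (λ x → map (λ y → f x y % N) ys) xs ≡ cartesianProductWith f xs ys
concatMap-%≡cartesianProductWith f xs ys <N = concatMap-map≡cartesianProductWith {xs = xs} {ys}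
  (λ x∈ y∈ → m<n⇒m%n≡m (All.lookup <N (∈-cartesianProductWith⁺ f x∈ y∈)))

map-unique : ∀ {A B : Set} {h : A → B} {l : List A} →
  (∀ {u u′} → u ∈ l → u′ ∈ l → h u ≡ h u′ → u ≡ u′) → Unique l → Unique (map h l)
map-unique {l = []}    _   []        = []
map-unique {l = u ∷ l} inj (u∉l ∷ l!) =
  All.map⁺ (All.tabulate λ u′∈ hu≡hu′ → All.lookup u∉l u′∈ (inj (here refl) (there u′∈) hu≡hu′))
  ∷ map-unique (λ u∈ u′∈ → inj (there u∈) (there u′∈)) l!

cartesianProductWith-unique : ∀ {A B C : Set} {f : A → B → C} {xs ys} →
  (∀ {x x′ y y′} → x ∈ xs → x′ ∈ xs → y ∈ ys → y′ ∈ ys → f x y ≡ f x′ y′ → x ≡ x′ × y ≡ y′) →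
  Unique xs → Unique ys → Unique (cartesianProductWith f xs ys)
cartesianProductWith-unique {xs = []}     _   []         _   = []
cartesianProductWith-unique {f = f} {x ∷ xs} {ys} inj (x∉xs ∷ xs!) ys! =
  ++⁺ (map-unique (λ y∈ y′∈ → proj₂ ∘ inj (here refl) (here refl) y∈ y′∈) ys!)
      (cartesianProductWith-unique (λ x∈ x′∈ → inj (there x∈) (there x′∈)) xs! ys!)
      disjoint
  where
  disjoint : Disjoint (map (f x) ys) (cartesianProductWith f xs ys)
  disjoint (v∈map , v∈prod) with ∈-map⁻ (f x) v∈map | ∈-cartesianProductWith⁻ f xs ys v∈prod
  ... | y , y∈ , refl | x′ , y′ , x′∈ , y′∈ , fxy≡fx′y′ =
    All.lookup x∉xs x′∈ (proj₁ (inj (here refl) (there x′∈) y∈ y′∈ fxy≡fx′y′))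

length-cartesianProductWith : ∀ {A B C : Set} (f : A → B → C) xs ys →
  length (cartesianProductWith f xs ys) ≡ length xs * length ys
length-cartesianProductWith f []       ys = refl
length-cartesianProductWith f (x ∷ xs) ys = trans (length-++ (map (f x) ys))
  (cong₂ _+_ (length-map (f x) ys) (length-cartesianProductWith f xs ys))

divMod-unique : ∀ {d} .{{_ : NonZero d}} {r r′ q q′} → r < d → r′ < d →
                r + q * d ≡ r′ + q′ * d → r ≡ r′ × q ≡ q′
divMod-unique {d} {r} {r′} {q} {q′} r<d r′<d eq =
  r≡r′ , *-cancelʳ-≡ q q′ d (+-cancelˡ-≡ r _ _ (trans eq (cong (_+ q′ * d) (sym r≡r′))))
  where
  open ≡-Reasoning
  r≡r′ : r ≡ r′
  r≡r′ = begin
    r                 ≡⟨ m<n⇒m%n≡m r<d ⟨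
    r % d             ≡⟨ [m+kn]%n≡m%n r q d ⟨
    (r + q * d) % d   ≡⟨ cong (_% d) eq ⟩
    (r′ + q′ * d) % d ≡⟨ [m+kn]%n≡m%n r′ q′ d ⟩
    r′ % d            ≡⟨ m<n⇒m%n≡m r′<d ⟩
    r′                ∎

positional-unique : ∀ {K e e′ β β′} .{{_ : NonZero K}} → 0 < e → e ≤ K → 0 < e′ → e′ ≤ K →
                    e + K * β ≡ e′ + K * β′ → e ≡ e′ × β ≡ β′
positional-unique {K} {suc p} {suc p′} {β} {β′} _ p<K _ p′<K eq =
  let p≡p′ , β≡β′ = divMod-unique p<K p′<K
        (trans (cong (p +_) (*-comm β K)) (trans (suc-injective eq) (cong (p′ +_) (*-comm K β′))))
  in cong suc p≡p′ , β≡β′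

-- The witnesses come from writing v − 1 = r + a(p + Kβ) with r < a and p < K:
-- then e = p + 1 and α = a − 1 − r.
solution-exists : ∀ {a K v} .{{_ : NonZero a}} .{{_ : NonZero K}} → 0 < v → v ≤ a * K * a →
  ∃[ e ] ∃[ α ] ∃[ β ] (0 < e × e ≤ K) × α < a × β < a × a * (e + K * β) ≡ v + α
solution-exists {a} {K} {suc w} _ v≤aKa =
  suc p , a ∸ suc r , β , (z<s , p<K) , ∸-monoʳ-< z<s r<a , β<a , solves
  where
  r t p β : ℕ
  r = w % a
  t = w / a
  p = t % K
  β = t / K
  r<a : r < a
  r<a = m%n<n w a
  p<K : p < K
  p<K = m%n<n t K
  β<a : β < a
  β<a = m<n*o⇒m/o<n (m<n*o⇒m/o<n v≤aKa)
  open ≡-Reasoning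
  solves : a * (suc p + K * β) ≡ suc w + (a ∸ suc r)
  solves = begin
    a * (suc p + K * β)           ≡⟨ expand a p K β ⟩
    a + (p + β * K) * a           ≡⟨ cong (λ s → a + s * a) (m≡m%n+[m/n]*n t K) ⟨
    a + t * a                     ≡⟨ cong (_+ t * a) (m+[n∸m]≡n r<a) ⟨
    suc r + (a ∸ suc r) + t * a   ≡⟨ regroup r (a ∸ suc r) (t * a) ⟩
    suc (r + t * a) + (a ∸ suc r) ≡⟨ cong (λ s → suc s + (a ∸ suc r)) (m≡m%n+[m/n]*n w a) ⟨
    suc w + (a ∸ suc r)           ∎
    where
    expand : ∀ a p K β → a * (suc p + K * β) ≡ a + (p + β * K) * a
    expand = solve-∀
    regroup : ∀ r s u → suc r + s + u ≡ suc (r + u) + s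
    regroup = solve-∀

solution-unique : ∀ {a K v e e′ α α′ β β′} .{{_ : NonZero a}} .{{_ : NonZero K}} →
  0 < e → e ≤ K → 0 < e′ → e′ ≤ K → α < a → α′ < a →
  a * (e + K * β) ≡ v + α → a * (e′ + K * β′) ≡ v + α′ → e ≡ e′ × α ≡ α′ × β ≡ β′
solution-unique {a} {K} {v} {e} {e′} {α} {α′} {β} {β′} 0<e e≤K 0<e′ e′≤K α<a α′<a sol sol′ =
  let α′≡α , same-quotient = divMod-unique α′<a α<a cross
      e≡e′ , β≡β′ = positional-unique 0<e e≤K 0<e′ e′≤K same-quotient
  in e≡e′ , sym α′≡α , β≡β′
  where
  open ≡-Reasoning
  cross : α′ + (e + K * β) * a ≡ α + (e′ + K * β′) * a
  cross = begin
    α′ + (e + K * β) * a   ≡⟨ cong (α′ +_) (trans (*-comm _ a) sol) ⟩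
    α′ + (v + α)           ≡⟨ swap-ends α′ v α ⟩
    α + (v + α′)           ≡⟨ cong (α +_) (trans (*-comm _ a) sol′) ⟨
    α + (e′ + K * β′) * a  ∎
    where
    swap-ends : ∀ x y z → x + (y + z) ≡ z + (y + x)
    swap-ends = solve-∀

Enumerates : ℕ → List ℕ → Set
Enumerates M l = (∀ {e} → e ∈ l → 0 < e × e ≤ M) × (∀ g → 0 < g → g ≤ M → count g l ≡ 1)

∑-solutions≡1 : ∀ {a K v} .{{_ : NonZero a}} .{{_ : NonZero K}} {E} →
  Enumerates K E → 0 < v → v ≤ a * K * a →
  ∑[ e ∈ E ] ∑[ α ∈ upTo a ] ∑[ β ∈ upTo a ] δ (a * (e + K * β)) (v + α) ≡ 1
∑-solutions≡1 {a} {K} {v} {E} (E-range , E-once) 0<v v≤aKa with solution-exists 0<v v≤aKa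
... | e₀ , α₀ , β₀ , (0<e₀ , e₀≤K) , α₀<a , β₀<a , sol₀ = begin
  ∑[ e ∈ E ] ∑[ α ∈ upTo a ] ∑[ β ∈ upTo a ] δ (a * (e + K * β)) (v + α)
    ≡⟨ ∑-collapse E (E-once e₀ 0<e₀ e₀≤K) (λ e∈E e≢e₀ →
         ∑-vanishing (upTo a) λ α∈ → ∑-vanishing (upTo a) λ {β} _ →
         ≢⇒δ≡0 (e≢e₀ ∘ proj₁ ∘ unique {β = β} (E-range e∈E) (∈-upTo⁻ α∈))) ⟩
  ∑[ α ∈ upTo a ] ∑[ β ∈ upTo a ] δ (a * (e₀ + K * β)) (v + α)
    ≡⟨ ∑-collapse (upTo a) (count-upTo α₀<a) (λ α∈ α≢α₀ → ∑-vanishing (upTo a) λ {β} _ →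
         ≢⇒δ≡0 (α≢α₀ ∘ proj₁ ∘ proj₂ ∘ unique {β = β} (0<e₀ , e₀≤K) (∈-upTo⁻ α∈))) ⟩
  ∑[ β ∈ upTo a ] δ (a * (e₀ + K * β)) (v + α₀)
    ≡⟨ ∑-collapse (upTo a) (count-upTo β₀<a) (λ {β} _ β≢β₀ →
         ≢⇒δ≡0 (β≢β₀ ∘ proj₂ ∘ proj₂ ∘ unique {β = β} (0<e₀ , e₀≤K) α₀<a)) ⟩
  δ (a * (e₀ + K * β₀)) (v + α₀)
    ≡⟨ ≡⇒δ≡1 sol₀ ⟩
  1 ∎
  where
  open ≡-Reasoning
  unique : ∀ {e α β} → 0 < e × e ≤ K → α < a → a * (e + K * β) ≡ v + α →
           e ≡ e₀ × α ≡ α₀ × β ≡ β₀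
  unique (0<e , e≤K) α<a sol = solution-unique 0<e e≤K 0<e₀ e₀≤K α<a α₀<a sol sol₀

Separated : List ℕ → List ℕ → Set
Separated xs ys = ∀ {x y} → x ∈ xs → y ∈ ys → x < y

forwardDiffs : List ℕ → List ℕ → List ℕ
forwardDiffs xs ys = cartesianProductWith _∸_ ys xs

forwardDiffs-range : ∀ {M xs ys} → Separated xs ys → All (_< suc M) ys →
                     ∀ {e} → e ∈ forwardDiffs xs ys → 0 < e × e ≤ M
forwardDiffs-range {M} {xs} {ys} sep ys<n e∈ with ∈-cartesianProductWith⁻ _∸_ ys xs e∈
... | y , x , y∈ , x∈ , refl =
  m<n⇒0<n∸m (sep x∈ y∈) , ≤-trans (m∸n≤m y x) (s≤s⁻¹ (All.lookup ys<n y∈))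

subℤ-≥ : ∀ {n} .{{_ : NonZero n}} {x y} → x ≤ y → y < n → subℤ n y x ≡ y ∸ x
subℤ-≥ {n} {x} {y} x≤y y<n = begin
  (y + (n ∸ x)) % n           ≡⟨ cong (λ z → (z + (n ∸ x)) % n) (m∸n+n≡m x≤y) ⟨
  (y ∸ x + x + (n ∸ x)) % n   ≡⟨ cong (_% n) (+-assoc (y ∸ x) x (n ∸ x)) ⟩
  (y ∸ x + (x + (n ∸ x))) % n ≡⟨ cong (λ z → (y ∸ x + z) % n) (m+[n∸m]≡n (≤-trans x≤y (<⇒≤ y<n))) ⟩
  (y ∸ x + n) % n             ≡⟨ [m+n]%n≡m%n (y ∸ x) n ⟩
  (y ∸ x) % n                 ≡⟨ m<n⇒m%n≡m (≤-<-trans (m∸n≤m y x) y<n) ⟩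
  y ∸ x                       ∎
  where open ≡-Reasoning

subℤ-< : ∀ {n} .{{_ : NonZero n}} {x y} → x < y → y < n → subℤ n x y ≡ n ∸ (y ∸ x)
subℤ-< {n} {x} {y} x<y y<n = begin
  (x + (n ∸ y)) % n     ≡⟨ m<n⇒m%n≡m (subst (x + (n ∸ y) <_) (m+[n∸m]≡n y≤n) (+-monoˡ-< (n ∸ y) x<y)) ⟩
  x + (n ∸ y)           ≡⟨ +-comm x (n ∸ y) ⟩
  n ∸ y + x             ≡⟨ cong (n ∸ y +_) (m∸[m∸n]≡n (<⇒≤ x<y)) ⟨
  n ∸ y + (y ∸ (y ∸ x)) ≡⟨ +-∸-assoc (n ∸ y) (m∸n≤m y x) ⟨
  n ∸ y + y ∸ (y ∸ x)   ≡⟨ cong (_∸ (y ∸ x)) (m∸n+n≡m y≤n) ⟩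
  n ∸ (y ∸ x)           ∎
  where
  open ≡-Reasoning
  y≤n : y ≤ n
  y≤n = <⇒≤ y<n

module _ {n} .{{_ : NonZero n}} {xs ys : List ℕ} (sep : Separated xs ys) (ys<n : All (_< n) ys)
  where

  diffs₁-separated : diffs n (pair xs ys) (suc zero) ≡ forwardDiffs xs ys
  diffs₁-separated = trans (cong (λ zs → concatMap (λ y → map (subℤ n y) zs) ys) (++-identityʳ xs))
    (concatMap-map≡cartesianProductWith (λ y∈ x∈ → subℤ-≥ (<⇒≤ (sep x∈ y∈)) (All.lookup ys<n y∈)))

  count-diffs₀-separated : ∀ {g} → g ≤ n →
    count g (diffs n (pair xs ys) zero) ≡ count (n ∸ g) (forwardDiffs xs ys)
  count-diffs₀-separated {g} g≤n = begin
    count g (diffs n (pair xs ys) zero)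
      ≡⟨ cong (λ zs → count g (concatMap (λ x → map (subℤ n x) zs) xs)) (++-identityʳ ys) ⟩
    count g (concatMap (λ x → map (subℤ n x) ys) xs)
      ≡⟨ cong (count g) (concatMap-map≡cartesianProductWith (λ x∈ y∈ → subℤ-< (sep x∈ y∈) (y<n y∈))) ⟩
    count g (cartesianProductWith (λ x y → n ∸ (y ∸ x)) xs ys)
      ≡⟨ count-cartesianProductWith _ xs ys ⟩
    ∑[ x ∈ xs ] ∑[ y ∈ ys ] δ (n ∸ (y ∸ x)) g
      ≡⟨ ∑-cong xs (λ {x} _ → ∑-cong ys (λ {y} y∈ →
           δ-reflect (≤-trans (m∸n≤m y x) (<⇒≤ (y<n y∈))) g≤n)) ⟩
    ∑[ x ∈ xs ] ∑[ y ∈ ys ] δ (y ∸ x) (n ∸ g)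
      ≡⟨ ∑-swap xs ys _ ⟩
    ∑[ y ∈ ys ] ∑[ x ∈ xs ] δ (y ∸ x) (n ∸ g)
      ≡⟨ count-cartesianProductWith _∸_ ys xs ⟨
    count (n ∸ g) (forwardDiffs xs ys) ∎
    where
    open ≡-Reasoning
    y<n : ∀ {y} → y ∈ ys → y < n
    y<n = All.lookup ys<n

IsSEDF⇒Enumerates : ∀ {M k xs ys} → IsSEDF (suc M) 2 k 1 (pair xs ys) → Separated xs ys →
                    Enumerates M (forwardDiffs xs ys)
IsSEDF⇒Enumerates {M} {k} {xs} {ys} H sep = forwardDiffs-range sep ys<n , once
  where
  ys<n : All (_< suc M) ys
  ys<n = IsSEDF.inZn H (suc zero)
  once : ∀ g → 0 < g → g ≤ M → count g (forwardDiffs xs ys) ≡ 1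
  once g 0<g g≤M = trans (cong (count g) (sym (diffs₁-separated sep ys<n)))
                         (IsSEDF.external H (suc zero) g 0<g (s≤s g≤M))

Enumerates⇒IsSEDF : ∀ {M k xs ys} → Separated xs ys → All (_< suc M) xs → All (_< suc M) ys →
  Unique xs → Unique ys → length xs ≡ k → length ys ≡ k → Enumerates M (forwardDiffs xs ys) →
  IsSEDF (suc M) 2 k 1 (pair xs ys)
Enumerates⇒IsSEDF {M} {k} {xs} {ys} sep xs<n ys<n xs! ys! |xs| |ys| (_ , once) = record
  { two≤m    = s≤s (s≤s z≤n)
  ; inZn     = λ { zero → xs<n ; (suc zero) → ys<n }
  ; distinct = λ { zero → xs! ; (suc zero) → ys! }
  ; size     = λ { zero → |xs| ; (suc zero) → |ys| }
  ; disjoint = disjoint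
  ; external = external
  }
  where
  disjoint : ∀ i j → i ≢ j → ∀ {v} → v ∈ pair xs ys i → v ∉ pair xs ys j
  disjoint zero       zero       i≢j = contradiction refl i≢j
  disjoint zero       (suc zero) _   v∈xs v∈ys = <-irrefl refl (sep v∈xs v∈ys)
  disjoint (suc zero) zero       _   v∈ys v∈xs = <-irrefl refl (sep v∈xs v∈ys)
  disjoint (suc zero) (suc zero) i≢j = contradiction refl i≢j
  external : ∀ i g → 0 < g → g < suc M → count g (diffs (suc M) (pair xs ys) i) ≡ 1
  external zero       g 0<g g<n = trans (count-diffs₀-separated sep ys<n (<⇒≤ g<n))
    (once (suc M ∸ g) (m<n⇒0<n∸m g<n) (∸-monoʳ-≤ (suc M) 0<g))
  external (suc zero) g 0<g g<n =
    trans (cong (count g) (diffs₁-separated sep ys<n)) (once g 0<g (s≤s⁻¹ g<n))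

-- B₁ and B₂ before reduction modulo N.
intervals : ℕ → List ℕ → List ℕ
intervals a xs = cartesianProductWith (λ x α → a * x + α) xs (upTo a)

progressions : ℕ → ℕ → List ℕ → List ℕ
progressions a K ys = cartesianProductWith (λ y β → a * (y + K * β)) ys (upTo a)

intervals-separated : ∀ {a K xs ys} → Separated xs ys →
                      Separated (intervals a xs) (progressions a K ys)
intervals-separated {a} {K} {xs} {ys} sep v∈ w∈
  with ∈-cartesianProductWith⁻ _ xs (upTo a) v∈ | ∈-cartesianProductWith⁻ _ ys (upTo a) w∈
... | x , α , x∈ , α∈ , refl | y , β , y∈ , _ , refl = begin-strict
  a * x + α       <⟨ +-monoʳ-< (a * x) (∈-upTo⁻ α∈) ⟩
  a * x + a       ≡⟨ trans (+-comm (a * x) a) (sym (*-suc a x)) ⟩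
  a * suc x       ≤⟨ *-monoʳ-≤ a (sep x∈ y∈) ⟩
  a * y           ≤⟨ *-monoʳ-≤ a (m≤m+n y (K * β)) ⟩
  a * (y + K * β) ∎
  where open ≤-Reasoning

progressions-bound : ∀ {a K ys} → (∀ {y} → y ∈ ys → y ≤ K) →
                     ∀ {v} → v ∈ progressions a K ys → v ≤ a * K * a
progressions-bound {a} {K} {ys} ys≤K v∈ with ∈-cartesianProductWith⁻ _ ys (upTo a) v∈
... | y , β , y∈ , β∈ , refl = begin
  a * (y + K * β) ≤⟨ *-monoʳ-≤ a (+-monoˡ-≤ (K * β) (ys≤K y∈)) ⟩
  a * (K + K * β) ≡⟨ cong (a *_) (*-suc K β) ⟨
  a * (K * suc β) ≤⟨ *-monoʳ-≤ a (*-monoʳ-≤ K (∈-upTo⁻ β∈)) ⟩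
  a * (K * a)     ≡⟨ *-assoc a K a ⟨
  a * K * a       ∎
  where open ≤-Reasoning

intervals-unique : ∀ {a xs} .{{_ : NonZero a}} → Unique xs → Unique (intervals a xs)
intervals-unique {a} {xs} xs! = cartesianProductWith-unique injective xs! (upTo⁺ a)
  where
  digits : ∀ x α → α + x * a ≡ a * x + α
  digits x α = trans (+-comm α (x * a)) (cong (_+ α) (*-comm x a))
  injective : ∀ {x x′ α α′} → x ∈ xs → x′ ∈ xs → α ∈ upTo a → α′ ∈ upTo a →
              a * x + α ≡ a * x′ + α′ → x ≡ x′ × α ≡ α′
  injective {x} {x′} {α} {α′} _ _ α∈ α′∈ eq =
    let α≡α′ , x≡x′ = divMod-unique (∈-upTo⁻ α∈) (∈-upTo⁻ α′∈)
                        (trans (digits x α) (trans eq (sym (digits x′ α′))))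
    in x≡x′ , α≡α′

progressions-unique : ∀ {a K ys} .{{_ : NonZero a}} .{{_ : NonZero K}} →
  (∀ {y} → y ∈ ys → 0 < y × y ≤ K) → Unique ys → Unique (progressions a K ys)
progressions-unique {a} {K} {ys} ys-range ys! = cartesianProductWith-unique injective ys! (upTo⁺ a)
  where
  injective : ∀ {y y′ β β′} → y ∈ ys → y′ ∈ ys → β ∈ upTo a → β′ ∈ upTo a →
              a * (y + K * β) ≡ a * (y′ + K * β′) → y ≡ y′ × β ≡ β′
  injective y∈ y′∈ _ _ eq =
    let 0<y , y≤K = ys-range y∈ ; 0<y′ , y′≤K = ys-range y′∈
    in positional-unique 0<y y≤K 0<y′ y′≤K (*-cancelˡ-≡ _ _ a eq)

blowup-difference : ∀ a K {x y} α β → x ≤ y →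
                    a * (y + K * β) ∸ (a * x + α) ≡ a * (y ∸ x + K * β) ∸ α
blowup-difference a K {x} {y} α β x≤y = begin
  a * (y + K * β) ∸ (a * x + α)
    ≡⟨ cong (λ z → a * (z + K * β) ∸ (a * x + α)) (m+[n∸m]≡n x≤y) ⟨
  a * (x + (y ∸ x) + K * β) ∸ (a * x + α)
    ≡⟨ cong (_∸ (a * x + α)) (distrib x (y ∸ x) (K * β)) ⟩
  a * x + a * (y ∸ x + K * β) ∸ (a * x + α)
    ≡⟨ [m+n]∸[m+o]≡n∸o (a * x) _ α ⟩
  a * (y ∸ x + K * β) ∸ α ∎
  where
  open ≡-Reasoning
  distrib : ∀ u v w → a * (u + v + w) ≡ a * u + a * (v + w)
  distrib u v w = trans (cong (a *_) (+-assoc u v w)) (*-distribˡ-+ a u (v + w))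

offset≤blowup : ∀ {a e α} K β → α < a → 0 < e → α ≤ a * (e + K * β)
offset≤blowup {a} {e} {α} K β α<a 0<e = begin
  α               ≤⟨ <⇒≤ α<a ⟩
  a               ≡⟨ *-identityʳ a ⟨
  a * 1           ≤⟨ *-monoʳ-≤ a 0<e ⟩
  a * e           ≤⟨ *-monoʳ-≤ a (m≤m+n e (K * β)) ⟩
  a * (e + K * β) ∎
  where open ≤-Reasoning

count-forwardDiffs-blowup : ∀ {a K v xs ys} → Separated xs ys →
  count v (forwardDiffs (intervals a xs) (progressions a K ys)) ≡
  ∑[ e ∈ forwardDiffs xs ys ] ∑[ α ∈ upTo a ] ∑[ β ∈ upTo a ] δ (a * (e + K * β)) (v + α)
count-forwardDiffs-blowup {a} {K} {v} {xs} {ys} sep = begin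
  count v (cartesianProductWith _∸_ (progressions a K ys) (intervals a xs))
    ≡⟨ count-cartesianProductWith _∸_ (progressions a K ys) (intervals a xs) ⟩
  ∑[ w ∈ progressions a K ys ] ∑[ u ∈ intervals a xs ] δ (w ∸ u) v
    ≡⟨ ∑-cartesianProductWith _ ys (upTo a) _ ⟩
  ∑[ y ∈ ys ] ∑[ β ∈ upTo a ] ∑[ u ∈ intervals a xs ] δ (a * (y + K * β) ∸ u) v
    ≡⟨ ∑-cong ys (λ _ → ∑-cong (upTo a) (λ _ → ∑-cartesianProductWith _ xs (upTo a) _)) ⟩
  ∑[ y ∈ ys ] ∑[ β ∈ upTo a ] ∑[ x ∈ xs ] ∑[ α ∈ upTo a ] δ (a * (y + K * β) ∸ (a * x + α)) v
    ≡⟨ ∑-cong ys (λ _ → ∑-swap (upTo a) xs _) ⟩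
  ∑[ y ∈ ys ] ∑[ x ∈ xs ] ∑[ β ∈ upTo a ] ∑[ α ∈ upTo a ] δ (a * (y + K * β) ∸ (a * x + α)) v
    ≡⟨ ∑-cong ys (λ _ → ∑-cong xs (λ _ → ∑-swap (upTo a) (upTo a) _)) ⟩
  ∑[ y ∈ ys ] ∑[ x ∈ xs ] ∑[ α ∈ upTo a ] ∑[ β ∈ upTo a ] δ (a * (y + K * β) ∸ (a * x + α)) v
    ≡⟨ ∑-cong ys (λ y∈ → ∑-cong xs (λ x∈ → ∑-cong (upTo a) (λ α∈ → ∑-cong (upTo a) (λ _ →
         summand (sep x∈ y∈) (∈-upTo⁻ α∈))))) ⟩
  ∑[ y ∈ ys ] ∑[ x ∈ xs ] ∑[ α ∈ upTo a ] ∑[ β ∈ upTo a ] δ (a * (y ∸ x + K * β)) (v + α)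
    ≡⟨ ∑-cartesianProductWith _∸_ ys xs _ ⟨
  ∑[ e ∈ forwardDiffs xs ys ] ∑[ α ∈ upTo a ] ∑[ β ∈ upTo a ] δ (a * (e + K * β)) (v + α) ∎
  where
  open ≡-Reasoning
  summand : ∀ {x y α β} → x < y → α < a →
            δ (a * (y + K * β) ∸ (a * x + α)) v ≡ δ (a * (y ∸ x + K * β)) (v + α)
  summand {x} {y} {α} {β} x<y α<a =
    trans (cong (λ z → δ z v) (blowup-difference a K α β (<⇒≤ x<y)))
          (δ-∸ (offset≤blowup K β α<a (m<n⇒0<n∸m x<y)))

IsSEDF-blowup : ∀ {K k a xs ys} .{{_ : NonZero K}} .{{_ : NonZero k}} .{{_ : NonZero a}} →
  IsSEDF (suc K) 2 k 1 (pair xs ys) → Separated xs ys →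
  IsSEDF (suc (a * K * a)) 2 (k * a) 1 (pair (intervals a xs) (progressions a K ys))
IsSEDF-blowup {K} {k} {a} {xs} {ys} H sep =
  Enumerates⇒IsSEDF sep′ intervals<n progressions<n
    (intervals-unique (H.distinct zero)) (progressions-unique ys-range (H.distinct (suc zero)))
    (blowup-length _ xs (H.size zero)) (blowup-length _ ys (H.size (suc zero)))
    (forwardDiffs-range sep′ progressions<n , λ v 0<v v≤ →
      trans (count-forwardDiffs-blowup {a} {K} sep) (∑-solutions≡1 (IsSEDF⇒Enumerates H sep) 0<v v≤))
  where
  module H = IsSEDF H
  sep′ : Separated (intervals a xs) (progressions a K ys)
  sep′ = intervals-separated {a} {K} sep
  nonempty-member : ∀ (l : List ℕ) → length l ≡ k → ∃[ u ] u ∈ l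
  nonempty-member []      |l|≡k = contradiction (sym |l|≡k) (≢-nonZero⁻¹ k)
  nonempty-member (u ∷ _) _     = u , here refl
  ys-range : ∀ {y} → y ∈ ys → 0 < y × y ≤ K
  ys-range y∈ = ≤-trans (s≤s z≤n) (sep (proj₂ (nonempty-member xs (H.size zero))) y∈)
              , s≤s⁻¹ (All.lookup (H.inZn (suc zero)) y∈)
  progressions<n : All (_< suc (a * K * a)) (progressions a K ys)
  progressions<n = All.tabulate (s≤s ∘ progressions-bound (proj₂ ∘ ys-range))
  intervals<n : All (_< suc (a * K * a)) (intervals a xs)
  intervals<n = All.tabulate λ v∈ → <-trans (sep′ v∈ w₀∈) (All.lookup progressions<n w₀∈)
    where
    y₀ : ∃[ y ] y ∈ ys
    y₀ = nonempty-member ys (H.size (suc zero))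
    w₀∈ : a * (proj₁ y₀ + K * 0) ∈ progressions a K ys
    w₀∈ = ∈-cartesianProductWith⁺ (λ y β → a * (y + K * β)) (proj₂ y₀) (∈-upTo⁺ (>-nonZero⁻¹ a))
  blowup-length : ∀ (f : ℕ → ℕ → ℕ) l → length l ≡ k →
                  length (cartesianProductWith f l (upTo a)) ≡ k * a
  blowup-length f l |l|≡k =
    trans (length-cartesianProductWith f l (upTo a)) (cong₂ _*_ |l|≡k (length-upTo a))

theorem5p3 : (k : ℕ) → 1 ≤ k → (xs ys : List ℕ)
    → IsSEDF (suc (k * k)) 2 k 1 (pair xs ys)
    → (∀ {x y} → x ∈ xs → y ∈ ys → x < y)
    → (a : ℕ) → 1 ≤ a
    → IsSEDF (suc ((a * k) * (a * k))) 2 (a * k) 1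
        (pair (B₁ (suc ((a * k) * (a * k))) a xs) (B₂ (suc ((a * k) * (a * k))) a k ys))
theorem5p3 k 1≤k xs ys H sep a 1≤a =
  subst₂ (λ M s → IsSEDF (suc M) 2 s 1 (pair (B₁ (suc M) a xs) (B₂ (suc M) a k ys)))
    (square a k) (*-comm k a)
    (subst₂ (λ B B′ → IsSEDF (suc (a * K * a)) 2 (k * a) 1 (pair B B′))
      (sym (concatMap-%≡cartesianProductWith (λ x α → a * x + α) xs (upTo a)
              (IsSEDF.inZn blown-up zero)))
      (sym (concatMap-%≡cartesianProductWith (λ y β → a * (y + K * β)) ys (upTo a)
              (IsSEDF.inZn blown-up (suc zero))))
      blown-up)
  where
  K : ℕ
  K = k * k
  instance
    k≢0 : NonZero k
    k≢0 = >-nonZero 1≤k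
    a≢0 : NonZero a
    a≢0 = >-nonZero 1≤a
    K≢0 : NonZero K
    K≢0 = m*n≢0 k k
  blown-up : IsSEDF (suc (a * K * a)) 2 (k * a) 1 (pair (intervals a xs) (progressions a K ys))
  blown-up = IsSEDF-blowup H sep
  square : ∀ a k → a * (k * k) * a ≡ (a * k) * (a * k)
  square = solve-∀
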